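{- Let $G$ be a snark, let $x,y$ be adjacent vertices of $G$, and let $\{aa',bb'\}$ be a matching of two edges of the Petersen graph $R$ at distance $1$ (some edge of $R$ joins an endpoint of $aa'$ to an endpoint of $bb'$). Then any dot-product $D$ of $G$ and $R$ obtained from $G-\{x,y\}$ and $R-\{aa',bb'\}$ that is a snark satisfies $\eta(D)\le 2/3$.
   Context: A bridge is an edge whose removal disconnects its endpoints. A cubic graph is Tait-colorable if its edge set can be partitioned into three perfect matchings; a snark is a bridgeless cubic graph that is not Tait-colorable. The Petersen graph $R$ has vertices $u_0,\dots,u_4,v_0,\dots,v_4$ and edges $u_iu_{i+1}$, $u_iv_i$, $v_iv_{i+2}$ (indices mod $5$). A dot-product of cubic graphs $G$ and $H$: choose adjacent vertices $x,y$ of $G$ and a matching $\{aa',bb'\}$ of two edges of $H$; let $x_1,x_2$ be the other neighbours of $x$ and $y_1,y_2$ the other neighbours of $y$ in $G$; the dot-product is obtained from the disjoint union of $G-\{x,y\}$ and $H-\{aa',bb'\}$ by adding the edges $ax_1,a'x_2,by_1,b'y_2$. For a graph $G=(V,E)$ admitting a perfect matching, a weight function is a map $w:E\to\mathbb{R}_{\ge 0}$ that is not identically zero; $w(E')=\sum_{e\in E'}w(e)$; $M^*(G)$ is a maximum weight matching and $P^*(G)$ a maximum weight perfect matching of $G$; $\eta(G)=\min_{w} \frac{w(P^*(G))}{w(M^*(G))}$. -}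

module Defs where

open import Data.Nat using (ℕ; zero; suc; _+_; _*_; _≤_; _<_)
open import Data.Fin using (Fin; zero; suc; toℕ)
open import Data.Bool using (Bool; true; false; if_then_else_; T; _∨_; _∧_)
open import Data.Product using (Σ; ∃; _×_; _,_)
open import Data.Sum using (_⊎_)
open import Relation.Binary.PropositionalEquality using (_≡_; _≢_)
open import Relation.Nullary using (¬_)
open import Function.Bundles using (_↔_)

sumFin : {n : ℕ} → (Fin n → ℕ) → ℕ
sumFin {zero}  f = 0
sumFin {suc n} f = f zero + sumFin {n} (λ i → f (suc i))

[_] : Bool → ℕ
[ b ] = if b then 1 else 0

record Graph : Set where
  field
    n      : ℕ
    adj    : Fin n → Fin n → Bool
    adj-sym    : ∀ u v → adj u v ≡ adj v u
    adj-irrefl : ∀ u → adj u u ≡ false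
open Graph public

Adj : (G : Graph) → Fin (n G) → Fin (n G) → Set
Adj G u v = T (adj G u v)

degree : (G : Graph) → Fin (n G) → ℕ
degree G u = sumFin (λ v → [ adj G u v ])

Cubic : Graph → Set
Cubic G = ∀ u → degree G u ≡ 3

data Reach {m : ℕ} (E : Fin m → Fin m → Bool) : Fin m → Fin m → Set where
  here : ∀ {u} → Reach E u u
  step : ∀ {u v w} → T (E u v) → Reach E v w → Reach E u w

_≟F_ : {m : ℕ} → Fin m → Fin m → Bool
_≟F_ i j = Data.Nat._≡ᵇ_ (toℕ i) (toℕ j)

deleteEdge : (G : Graph) → Fin (n G) → Fin (n G) → Fin (n G) → Fin (n G) → Bool
deleteEdge G a b u v =
  adj G u v ∧ Data.Bool.not (((u ≟F a) ∧ (v ≟F b)) ∨ ((u ≟F b) ∧ (v ≟F a)))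

IsBridge : (G : Graph) → Fin (n G) → Fin (n G) → Set
IsBridge G a b = Adj G a b × ¬ Reach (deleteEdge G a b) a b

Bridgeless : Graph → Set
Bridgeless G = ∀ a b → ¬ IsBridge G a b

record EdgeSubset (G : Graph) : Set where
  field
    mem     : Fin (n G) → Fin (n G) → Bool
    mem-sym : ∀ u v → mem u v ≡ mem v u
    mem-adj : ∀ u v → T (mem u v) → Adj G u v
open EdgeSubset public

degIn : {G : Graph} → EdgeSubset G → Fin (n G) → ℕ
degIn F u = sumFin (λ v → [ mem F u v ])

IsMatching : {G : Graph} → EdgeSubset G → Set
IsMatching {G} F = ∀ u → degIn F u ≤ 1

IsPerfectMatching : {G : Graph} → EdgeSubset G → Set
IsPerfectMatching {G} F = ∀ u → degIn F u ≡ 1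

record TaitColouring (G : Graph) : Set where
  field
    colour     : Fin (n G) → Fin (n G) → Fin 3
    colour-sym : ∀ u v → colour u v ≡ colour v u
    classPerfect : ∀ (k : Fin 3) → ∀ u →
      sumFin (λ v → [ adj G u v ∧ (colour u v ≟F k) ]) ≡ 1

TaitColourable : Graph → Set
TaitColourable G = TaitColouring G

Snark : Graph → Set
Snark G = Cubic G × Bridgeless G × ¬ TaitColourable G

-- Weights.  A weight function assigns to each edge {u,v} (u < v) the
-- value w u v; only values on edges matter.

_<F_ : {m : ℕ} → Fin m → Fin m → Bool
i <F j = Data.Nat._<ᵇ_ (toℕ i) (toℕ j)

weightOf : {G : Graph} → (Fin (n G) → Fin (n G) → ℕ) → EdgeSubset G → ℕ
weightOf {G} w F =
  sumFin (λ u → sumFin (λ v → if (u <F v) ∧ mem F u v then w u v else 0))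

NonZeroWeight : (G : Graph) → (Fin (n G) → Fin (n G) → ℕ) → Set
NonZeroWeight G w = Σ (Fin (n G)) λ u → Σ (Fin (n G)) λ v →
  T (u <F v) × Adj G u v × 0 < w u v

-- η(G) ≤ p/q : there is a (nonzero, nonnegative) weight function w with
-- w(P*(G)) / w(M*(G)) ≤ p/q, i.e. some matching M such that every perfect
-- matching P satisfies q·w(P) ≤ p·w(M).
EtaAtMost : Graph → ℕ → ℕ → Set
EtaAtMost G p q =
  Σ (Fin (n G) → Fin (n G) → ℕ) λ w → NonZeroWeight G w ×
  Σ (EdgeSubset G) λ M → IsMatching M ×
  (∀ (P : EdgeSubset G) → IsPerfectMatching P → q * weightOf w P ≤ p * weightOf w M)

-- The Petersen graph R: u_i = i, v_i = 5 + i (i = 0..4).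
-- Edges u_i u_{i+1}, u_i v_i, v_i v_{i+2}.

petersenEdges : Fin 10 → Fin 10 → Bool
petersenEdges i j with toℕ i | toℕ j
... | 0 | 1 = true
... | 1 | 2 = true
... | 2 | 3 = true
... | 3 | 4 = true
... | 4 | 0 = true
... | 0 | 5 = true
... | 1 | 6 = true
... | 2 | 7 = true
... | 3 | 8 = true
... | 4 | 9 = true
... | 5 | 7 = true
... | 6 | 8 = true
... | 7 | 9 = true
... | 8 | 5 = true
... | 9 | 6 = true
... | _ | _ = false

petersenAdj : Fin 10 → Fin 10 → Bool
petersenAdj i j = petersenEdges i j ∨ petersenEdges j i

private
  ∨-comm : ∀ a b → (a ∨ b) ≡ (b ∨ a)
  ∨-comm false false = Relation.Binary.PropositionalEquality.refl
  ∨-comm false true  = Relation.Binary.PropositionalEquality.refl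
  ∨-comm true  false = Relation.Binary.PropositionalEquality.refl
  ∨-comm true  true  = Relation.Binary.PropositionalEquality.refl

  petersen-irrefl : ∀ u → petersenAdj u u ≡ false
  petersen-irrefl zero = Relation.Binary.PropositionalEquality.refl
  petersen-irrefl (suc zero) = Relation.Binary.PropositionalEquality.refl
  petersen-irrefl (suc (suc zero)) = Relation.Binary.PropositionalEquality.refl
  petersen-irrefl (suc (suc (suc zero))) = Relation.Binary.PropositionalEquality.refl
  petersen-irrefl (suc (suc (suc (suc zero)))) = Relation.Binary.PropositionalEquality.refl
  petersen-irrefl (suc (suc (suc (suc (suc zero))))) = Relation.Binary.PropositionalEquality.refl
  petersen-irrefl (suc (suc (suc (suc (suc (suc zero)))))) = Relation.Binary.PropositionalEquality.refl
  petersen-irrefl (suc (suc (suc (suc (suc (suc (suc zero))))))) = Relation.Binary.PropositionalEquality.refl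
  petersen-irrefl (suc (suc (suc (suc (suc (suc (suc (suc zero)))))))) = Relation.Binary.PropositionalEquality.refl
  petersen-irrefl (suc (suc (suc (suc (suc (suc (suc (suc (suc zero))))))))) = Relation.Binary.PropositionalEquality.refl

Petersen : Graph
Petersen = record
  { n = 10
  ; adj = petersenAdj
  ; adj-sym = λ u v → ∨-comm (petersenEdges u v) (petersenEdges v u)
  ; adj-irrefl = petersen-irrefl
  }

SameEdge : {m : ℕ} → Fin m → Fin m → Fin m → Fin m → Set
SameEdge i j a b = (i ≡ a × j ≡ b) ⊎ (i ≡ b × j ≡ a)

VertsMinus : (G : Graph) → Fin (n G) → Fin (n G) → Set
VertsMinus G x y = Σ (Fin (n G)) λ v → v ≢ x × v ≢ y

DotVerts : (G : Graph) → Fin (n G) → Fin (n G) → (H : Graph) → Set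
DotVerts G x y H = VertsMinus G x y ⊎ Fin (n H)

Link : {G H : Graph} → (x₁ x₂ y₁ y₂ : Fin (n G)) → (a a' b b' : Fin (n H)) →
       Fin (n G) → Fin (n H) → Set
Link x₁ x₂ y₁ y₂ a a' b b' g i =
  (g ≡ x₁ × i ≡ a) ⊎ (g ≡ x₂ × i ≡ a') ⊎ (g ≡ y₁ × i ≡ b) ⊎ (g ≡ y₂ × i ≡ b')

DotAdj : (G : Graph) (x y x₁ x₂ y₁ y₂ : Fin (n G))
         (H : Graph) (a a' b b' : Fin (n H)) →
         DotVerts G x y H → DotVerts G x y H → Set
DotAdj G x y x₁ x₂ y₁ y₂ H a a' b b' (Data.Sum.inj₁ (g , _)) (Data.Sum.inj₁ (h , _)) =
  Adj G g h
DotAdj G x y x₁ x₂ y₁ y₂ H a a' b b' (Data.Sum.inj₂ i) (Data.Sum.inj₂ j) =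
  Adj H i j × ¬ SameEdge i j a a' × ¬ SameEdge i j b b'
DotAdj G x y x₁ x₂ y₁ y₂ H a a' b b' (Data.Sum.inj₁ (g , _)) (Data.Sum.inj₂ i) =
  Link {G} {H} x₁ x₂ y₁ y₂ a a' b b' g i
DotAdj G x y x₁ x₂ y₁ y₂ H a a' b b' (Data.Sum.inj₂ i) (Data.Sum.inj₁ (g , _)) =
  Link {G} {H} x₁ x₂ y₁ y₂ a a' b b' g i

record DotData (G H : Graph) : Set where
  field
    x y x₁ x₂ y₁ y₂ : Fin (n G)
    xy   : Adj G x y
    xx₁  : Adj G x x₁
    xx₂  : Adj G x x₂
    x₁≢x₂ : x₁ ≢ x₂
    x₁≢y : x₁ ≢ y
    x₂≢y : x₂ ≢ y
    yy₁  : Adj G y y₁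
    yy₂  : Adj G y y₂
    y₁≢y₂ : y₁ ≢ y₂
    y₁≢x : y₁ ≢ x
    y₂≢x : y₂ ≢ x
    a a' b b' : Fin (n H)
    aa'  : Adj H a a'
    bb'  : Adj H b b'
    a≢b : a ≢ b
    a≢b' : a ≢ b'
    a'≢b : a' ≢ b
    a'≢b' : a' ≢ b'
open DotData public

IsDotProductVia : (G H : Graph) → DotData G H → Graph → Set
IsDotProductVia G H dd D =
  Σ (Fin (n D) ↔ DotVerts G (x dd) (y dd) H) λ φ →
    ∀ p q → (Adj D p q → DotAdj G (x dd) (y dd) (x₁ dd) (x₂ dd) (y₁ dd) (y₂ dd)
                                  H (a dd) (a' dd) (b dd) (b' dd)
                                  (Function.Bundles.Inverse.to φ p)
                                  (Function.Bundles.Inverse.to φ q))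
          × (DotAdj G (x dd) (y dd) (x₁ dd) (x₂ dd) (y₁ dd) (y₂ dd)
                                  H (a dd) (a' dd) (b dd) (b' dd)
                                  (Function.Bundles.Inverse.to φ p)
                                  (Function.Bundles.Inverse.to φ q) → Adj D p q)

AtDistanceOne : (H : Graph) → (a a' b b' : Fin (n H)) → Set
AtDistanceOne H a a' b b' =
  Adj H a b ⊎ Adj H a b' ⊎ Adj H a' b ⊎ Adj H a' b'

module Submission where

-- Call a vertex z of a graph "surrounded" by a list of
-- pairwise disjoint edges e₀, …, e_k when z is not an endpoint of any of
-- them and every neighbour of z is an endpoint of one of them.  Give
-- weight 1 to these k+1 edges and 0 to all other edges.  They form a
-- matching of weight k+1, while a perfect matching P must match z to an
-- endpoint of some eᵢ, so P cannot contain eᵢ and has weight at most k.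
-- Hence η ≤ k/(k+1) for every graph with a surrounded vertex.
--
-- In a
-- dot-product D of G and H the graph H − {aa', bb'} embeds into D, and a
-- vertex of H off aa' and bb' keeps its neighbourhood.  Finally a finite
-- computation shows that for every matching {aa', bb'} of the Petersen
-- graph one of five fixed vertices avoids aa', bb' and is surrounded by
-- three edges of R − {aa', bb'}; this gives η(D) ≤ 2/3.

open import Defs
open import Algebra.Properties.CommutativeSemigroup as CSemigroup using ()
open import Data.Bool using (Bool; true; false; T; _∧_; _∨_; if_then_else_)
open import Data.Bool.Properties using (T-∧; T-∨; ∧-comm; ∨-comm; ∧-zeroʳ)
open import Data.Empty using (⊥; ⊥-elim)
open import Data.Fin using (Fin; zero; suc; toℕ; _≟_)
open import Data.Fin.Patterns using (0F; 1F; 2F; 3F; 4F; 5F; 6F; 7F; 8F; 9F)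
open import Data.Fin.Properties using (suc-injective; toℕ-injective) renaming (all? to allFin?)
open import Data.List using (List; []; _∷_; map; length)
open import Data.List.Membership.Propositional using (_∈_; _∉_)
open import Data.List.Membership.Propositional.Properties using (∈-map⁺; ∈-map⁻)
import Data.List.Membership.DecPropositional as DecMembership
open import Data.List.Relation.Unary.All as All using (All; []; _∷_)
open import Data.List.Relation.Unary.AllPairs using (_∷_)
open import Data.List.Relation.Unary.All.Properties using (All¬⇒¬Any) renaming (map⁺ to All-map⁺)
open import Data.List.Relation.Unary.Any as Any using (Any; here; there)
open import Data.List.Relation.Unary.Unique.Propositional using (Unique)
import Data.List.Relation.Unary.Unique.Propositional.Properties as Unique
import Data.List.Relation.Unary.Unique.DecPropositional as DecUnique
open import Data.Nat using (ℕ; zero; suc; _+_; _*_; _≤_; _<_; _<?_; _<ᵇ_; z≤n; s≤s; z<s)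
open import Data.Nat.Properties
  using ( +-identityʳ; +-comm; +-suc; *-comm; ≤-trans; ≤-pred; m≤m+n; m≤n+m
        ; +-mono-≤; +-monoʳ-≤; *-monoʳ-≤; <-≤-trans; <-irrefl; <-cmp; <⇒<ᵇ; n≤0⇒n≡0; ≮⇒≥
        ; +-commutativeSemigroup )
open import Data.Product using (Σ; _×_; _,_; proj₁; proj₂)
open import Data.Sum using (_⊎_; inj₁; inj₂)
import Data.Sum as Sum
open import Data.Sum.Properties using (inj₂-injective)
open import Function using (_∘_)
open import Function.Bundles using (Inverse; Equivalence)
open import Relation.Binary using (tri<; tri≈; tri>)
open import Relation.Binary.PropositionalEquality
  using (_≡_; _≢_; refl; sym; trans; cong; cong₂; subst; subst₂; module ≡-Reasoning)
open import Relation.Nullary using (¬_; Dec; yes; no; ¬?; does)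
open import Relation.Nullary.Decidable
  using (_×-dec_; _⊎-dec_; _→-dec_; from-yes; map′; dec-true; dec-false; T?)

open CSemigroup +-commutativeSemigroup using (interchange)

sumFin-cong : ∀ {m} {f g : Fin m → ℕ} → (∀ i → f i ≡ g i) → sumFin f ≡ sumFin g
sumFin-cong {zero}  eq = refl
sumFin-cong {suc m} eq = cong₂ _+_ (eq zero) (sumFin-cong (eq ∘ suc))

sumFin-+ : ∀ {m} (f g : Fin m → ℕ) → sumFin (λ i → f i + g i) ≡ sumFin f + sumFin g
sumFin-+ {zero}  f g = refl
sumFin-+ {suc m} f g =
  trans (cong (f zero + g zero +_) (sumFin-+ (f ∘ suc) (g ∘ suc)))
        (interchange (f zero) (g zero) (sumFin (f ∘ suc)) (sumFin (g ∘ suc)))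

sumFin-zero : ∀ {m} {f : Fin m → ℕ} → (∀ i → f i ≡ 0) → sumFin f ≡ 0
sumFin-zero {zero}  z = refl
sumFin-zero {suc m} z = cong₂ _+_ (z zero) (sumFin-zero (z ∘ suc))

sumFin-point : ∀ {m} {f : Fin m → ℕ} (p : Fin m) → (∀ i → i ≢ p → f i ≡ 0) →
               sumFin f ≡ f p
sumFin-point {f = f} zero z =
  trans (cong (f zero +_) (sumFin-zero (λ i → z (suc i) λ ()))) (+-identityʳ (f zero))
sumFin-point (suc p) z =
  cong₂ _+_ (z zero λ ()) (sumFin-point p (λ i i≢p → z (suc i) (i≢p ∘ suc-injective)))

sumFin-≥ : ∀ {m} (f : Fin m → ℕ) (p : Fin m) → f p ≤ sumFin f
sumFin-≥ f zero    = m≤m+n (f zero) _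
sumFin-≥ f (suc p) = ≤-trans (sumFin-≥ (f ∘ suc) p) (m≤n+m _ (f zero))

sumFin-two : ∀ {m} (f : Fin m → ℕ) {i j : Fin m} → i ≢ j → f i + f j ≤ sumFin f
sumFin-two f {zero}  {zero}  i≢j = ⊥-elim (i≢j refl)
sumFin-two f {zero}  {suc j} _   = +-monoʳ-≤ (f zero) (sumFin-≥ (f ∘ suc) j)
sumFin-two f {suc i} {zero}  _   =
  subst (_≤ sumFin f) (+-comm (f zero) (f (suc i))) (+-monoʳ-≤ (f zero) (sumFin-≥ (f ∘ suc) i))
sumFin-two f {suc i} {suc j} i≢j =
  ≤-trans (sumFin-two (f ∘ suc) (i≢j ∘ cong suc)) (m≤n+m _ (f zero))

sumFin-positive : ∀ {m} (f : Fin m → ℕ) → 0 < sumFin f → Σ (Fin m) λ i → 0 < f i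
sumFin-positive {suc m} f pos with f zero in eq
... | suc _ = zero , subst (0 <_) (sym eq) z<s
... | zero  with sumFin-positive (f ∘ suc) pos
...   | i , fi>0 = suc i , fi>0

sumFin-atMostOne : ∀ {m} (f : Fin m → ℕ) → (∀ i → f i ≤ 1) →
                   (∀ i j → 0 < f i → 0 < f j → i ≡ j) → sumFin f ≤ 1
sumFin-atMostOne {zero}  f _  _    = z≤n
sumFin-atMostOne {suc m} f ≤1 uniq with 0 <? f zero
... | yes f₀>0 = subst (_≤ 1) (sym (sumFin-point zero vanish)) (≤1 zero)
  where
  vanish : ∀ i → i ≢ zero → f i ≡ 0
  vanish i i≢0 = n≤0⇒n≡0 (≮⇒≥ λ fᵢ>0 → i≢0 (uniq i zero fᵢ>0 f₀>0))
... | no  f₀≯0 =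
  subst (λ x → x + sumFin (f ∘ suc) ≤ 1) (sym (n≤0⇒n≡0 (≮⇒≥ f₀≯0)))
        (sumFin-atMostOne (f ∘ suc) (≤1 ∘ suc)
                          (λ i j fᵢ fⱼ → suc-injective (uniq (suc i) (suc j) fᵢ fⱼ)))

_≡?_ : ∀ {m} → Fin m → Fin m → Bool
i ≡? j = does (i ≟ j)

≡?-refl : ∀ {m} (i : Fin m) → (i ≡? i) ≡ true
≡?-refl i = dec-true (i ≟ i) refl

≡?-sound : ∀ {m} {i j : Fin m} → T (i ≡? j) → i ≡ j
≡?-sound {i = i} {j} t with i ≟ j
... | yes i≡j = i≡j
... | no  _   = ⊥-elim t

≡?-false : ∀ {m} {i j : Fin m} → i ≢ j → (i ≡? j) ≡ false
≡?-false {i = i} {j} = dec-false (i ≟ j)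

[]≤1 : ∀ b → [ b ] ≤ 1
[]≤1 true  = s≤s z≤n
[]≤1 false = z≤n

[]-true : ∀ {b} → T b → [ b ] ≡ 1
[]-true {true} _ = refl

[]-false : ∀ {b} → ¬ T b → [ b ] ≡ 0
[]-false {true}  ¬b = ⊥-elim (¬b _)
[]-false {false} _  = refl

[]-positive : ∀ {b} → 0 < [ b ] → T b
[]-positive {true} _ = _

-- Of two comparisons m <ᵇ k and k <ᵇ m between distinct numbers exactly one
-- holds, so an edge {p,q} is counted once by weightOf.
<ᵇ-exactlyOne : ∀ {m k} → m ≢ k → ∀ b → [ (m <ᵇ k) ∧ b ] + [ (k <ᵇ m) ∧ b ] ≡ [ b ]
<ᵇ-exactlyOne {zero}  {zero}  m≢k b = ⊥-elim (m≢k refl)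
<ᵇ-exactlyOne {zero}  {suc k} _   b = +-identityʳ [ b ]
<ᵇ-exactlyOne {suc m} {zero}  _   b = refl
<ᵇ-exactlyOne {suc m} {suc k} m≢k b = <ᵇ-exactlyOne (m≢k ∘ cong suc) b

-- Lists of edges, given as pairs of endpoints; ends lists all endpoints,
-- so the edges are pairwise disjoint exactly when ends has no repetitions.

Pair : Set → Set
Pair A = A × A

ends : {A : Set} → List (Pair A) → List A
ends []             = []
ends ((p , q) ∷ es) = p ∷ q ∷ ends es

mapPair : {A B : Set} → (A → B) → Pair A → Pair B
mapPair f (p , q) = f p , f q

ends-map : {A B : Set} (f : A → B) (es : List (Pair A)) →
           ends (map (mapPair f) es) ≡ map f (ends es)
ends-map f []             = refl
ends-map f ((p , q) ∷ es) = cong (λ xs → f p ∷ f q ∷ xs) (ends-map f es)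

record Surrounded {A : Set} (E : A → A → Set) (c : A) (es : List (Pair A)) : Set where
  field
    edges      : All (λ e → E (proj₁ e) (proj₂ e)) es
    disjoint   : Unique (ends es)
    centre∉    : c ∉ ends es
    neighbours : ∀ t → E c t → t ∈ ends es
open Surrounded

surrounded-restrict : {A : Set} {E E' : A → A → Set} {c : A} {es : List (Pair A)} →
  (∀ {i j} → E' i j → E i j) → All (λ e → E' (proj₁ e) (proj₂ e)) es →
  Surrounded E c es → Surrounded E' c es
surrounded-restrict E'⊆E es⊆E' s = record
  { edges = es⊆E' ; disjoint = disjoint s ; centre∉ = centre∉ s
  ; neighbours = λ t ct → neighbours s t (E'⊆E ct) }

surrounded-embed : {A B : Set} {E : A → A → Set} {E' : B → B → Set} {c : A} {es : List (Pair A)}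
  (f : A → B) → (∀ {i j} → f i ≡ f j → i ≡ j) → (∀ {i j} → E i j → E' (f i) (f j)) →
  (∀ t → E' (f c) t → Σ A λ j → t ≡ f j × E c j) →
  Surrounded E c es → Surrounded E' (f c) (map (mapPair f) es)
surrounded-embed {E' = E'} {c = c} {es} f f-inj f-edge f-nbr s = record
  { edges      = All-map⁺ (All.map f-edge (edges s))
  ; disjoint   = subst Unique (sym (ends-map f es)) (Unique.map⁺ f-inj (disjoint s))
  ; centre∉    = centre∉′
  ; neighbours = neighbours′
  }
  where
  centre∉′ : f c ∉ ends (map (mapPair f) es)
  centre∉′ fc∈ with ∈-map⁻ f (subst (f c ∈_) (ends-map f es) fc∈)
  ... | j , j∈ , fc≡fj = centre∉ s (subst (_∈ ends es) (sym (f-inj fc≡fj)) j∈)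

  neighbours′ : ∀ t → E' (f c) t → t ∈ ends (map (mapPair f) es)
  neighbours′ t ct with f-nbr t ct
  ... | j , refl , cj = subst (f j ∈_) (sym (ends-map f es)) (∈-map⁺ f (neighbours s j cj))

module _ {G : Graph} where

  private
    V : Set
    V = Fin (n G)

    Weight : Set
    Weight = V → V → ℕ

  adj⇒≢ : {p q : V} → Adj G p q → p ≢ q
  adj⇒≢ {p} pq refl = subst T (adj-irrefl G p) pq

  adj-sym′ : {p q : V} → Adj G p q → Adj G q p
  adj-sym′ {p} {q} = subst T (adj-sym G p q)

  private
    if-+ : ∀ c (x y : ℕ) → (if c then x + y else 0) ≡ (if c then x else 0) + (if c then y else 0)
    if-+ true  x y = refl
    if-+ false x y = refl

    if-0 : ∀ c {x : ℕ} → x ≡ 0 → (if c then x else 0) ≡ 0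
    if-0 true  x≡0 = x≡0
    if-0 false _   = refl

  weightOf-+ : (w₁ w₂ : Weight) (F : EdgeSubset G) →
    weightOf (λ u v → w₁ u v + w₂ u v) F ≡ weightOf w₁ F + weightOf w₂ F
  weightOf-+ w₁ w₂ F =
    trans (sumFin-cong λ u → trans (sumFin-cong λ v → if-+ (c u v) (w₁ u v) (w₂ u v))
                                   (sumFin-+ (term w₁ u) (term w₂ u)))
          (sumFin-+ (λ u → sumFin (term w₁ u)) (λ u → sumFin (term w₂ u)))
    where
    c : V → V → Bool
    c u v = (u <F v) ∧ mem F u v
    term : Weight → V → V → ℕ
    term w u v = if c u v then w u v else 0

  weightOf-zero : (F : EdgeSubset G) → weightOf {G} (λ _ _ → 0) F ≡ 0
  weightOf-zero F = sumFin-zero λ u → sumFin-zero λ v → if-0 ((u <F v) ∧ mem F u v) refl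

  weightOf-single : (w : Weight) (p q : V) → (∀ u v → u ≢ p ⊎ v ≢ q → w u v ≡ 0) →
    (F : EdgeSubset G) → weightOf w F ≡ (if (p <F q) ∧ mem F p q then w p q else 0)
  weightOf-single w p q support F =
    trans (sumFin-cong λ u → sumFin-point q λ v v≢q →
             if-0 ((u <F v) ∧ mem F u v) (support u v (inj₂ v≢q)))
          (sumFin-point p λ u u≢p → if-0 ((u <F q) ∧ mem F u q) (support u q (inj₁ u≢p)))

  arc : V → V → V → V → Bool
  arc p q u v = (u ≡? p) ∧ (v ≡? q)

  arc-self : (p q : V) → arc p q p q ≡ true
  arc-self p q = cong₂ _∧_ (≡?-refl p) (≡?-refl q)

  arc-sound : {p q u v : V} → T (arc p q u v) → u ≡ p × v ≡ q
  arc-sound {p} {q} {u} {v} t with Equivalence.to (T-∧ {u ≡? p}) t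
  ... | u≡p , v≡q = ≡?-sound u≡p , ≡?-sound v≡q

  arc-elsewhere : {p q u v : V} → u ≢ p ⊎ v ≢ q → [ arc p q u v ] ≡ 0
  arc-elsewhere {v = v} (inj₁ u≢p) = cong (λ b → [ b ∧ (v ≡? _) ]) (≡?-false u≢p)
  arc-elsewhere {p = p} {u = u} (inj₂ v≢q) =
    cong [_] (trans (cong ((u ≡? p) ∧_) (≡?-false v≢q)) (∧-zeroʳ (u ≡? p)))

  edgeWeight : Pair V → Weight
  edgeWeight (p , q) u v = [ arc p q u v ] + [ arc q p u v ]

  weightOf-edge : {p q : V} → Adj G p q → (F : EdgeSubset G) →
                  weightOf (edgeWeight (p , q)) F ≡ [ mem F p q ]
  weightOf-edge {p} {q} pq F = begin
    weightOf (edgeWeight (p , q)) F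
      ≡⟨ weightOf-+ (λ u v → [ arc p q u v ]) (λ u v → [ arc q p u v ]) F ⟩
    weightOf (λ u v → [ arc p q u v ]) F + weightOf (λ u v → [ arc q p u v ]) F
      ≡⟨ cong₂ _+_ (once p q) (once q p) ⟩
    [ (p <F q) ∧ mem F p q ] + [ (q <F p) ∧ mem F q p ]
      ≡⟨ cong (λ b → [ (p <F q) ∧ mem F p q ] + [ (q <F p) ∧ b ]) (mem-sym F q p) ⟩
    [ (p <F q) ∧ mem F p q ] + [ (q <F p) ∧ mem F p q ]
      ≡⟨ <ᵇ-exactlyOne (adj⇒≢ pq ∘ toℕ-injective) (mem F p q) ⟩
    [ mem F p q ] ∎
    where
    open ≡-Reasoning
    once : (r s : V) → weightOf (λ u v → [ arc r s u v ]) F ≡ [ (r <F s) ∧ mem F r s ]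
    once r s = trans (weightOf-single _ r s (λ u v → arc-elsewhere) F)
                     (cong (λ b → if (r <F s) ∧ mem F r s then [ b ] else 0) (arc-self r s))

  edgeWeight-positive : {p q u v : V} → SameEdge u v p q → 0 < edgeWeight (p , q) u v
  edgeWeight-positive {p} {q} (inj₁ (refl , refl)) rewrite arc-self p q = z<s
  edgeWeight-positive {p} {q} (inj₂ (refl , refl)) rewrite arc-self q p =
    <-≤-trans z<s (m≤n+m 1 [ arc p q q p ])

  edgesWeight : List (Pair V) → Weight
  edgesWeight []       u v = 0
  edgesWeight (e ∷ es) u v = edgeWeight e u v + edgesWeight es u v

  count : EdgeSubset G → List (Pair V) → ℕ
  count F []             = 0
  count F ((p , q) ∷ es) = [ mem F p q ] + count F es

  weightOf-edges : {es : List (Pair V)} → All (λ e → Adj G (proj₁ e) (proj₂ e)) es →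
                   (F : EdgeSubset G) → weightOf (edgesWeight es) F ≡ count F es
  weightOf-edges []                         F = weightOf-zero F
  weightOf-edges {(p , q) ∷ es} (pq ∷ rest) F =
    trans (weightOf-+ (edgeWeight (p , q)) (edgesWeight es) F)
          (cong₂ _+_ (weightOf-edge pq F) (weightOf-edges rest F))

  edgesWeight-nonzero : {p q : V} {es : List (Pair V)} → Adj G p q →
                        NonZeroWeight G (edgesWeight ((p , q) ∷ es))
  edgesWeight-nonzero {p} {q} pq with <-cmp (toℕ p) (toℕ q)
  ... | tri< p<q _ _ = p , q , <⇒<ᵇ p<q , pq ,
                       <-≤-trans (edgeWeight-positive {p} {q} (inj₁ (refl , refl))) (m≤m+n _ _)
  ... | tri≈ _ p≡q _ = ⊥-elim (adj⇒≢ pq (toℕ-injective p≡q))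
  ... | tri> _ _ q<p = q , p , <⇒<ᵇ q<p , adj-sym′ pq ,
                       <-≤-trans (edgeWeight-positive {p} {q} (inj₂ (refl , refl))) (m≤m+n _ _)

  count-all : (F : EdgeSubset G) {es : List (Pair V)} →
              All (λ e → T (mem F (proj₁ e) (proj₂ e))) es → count F es ≡ length es
  count-all F []         = refl
  count-all F (t ∷ rest) = cong₂ _+_ ([]-true t) (count-all F rest)

  count-≤ : (F : EdgeSubset G) (es : List (Pair V)) → count F es ≤ length es
  count-≤ F []             = z≤n
  count-≤ F ((p , q) ∷ es) = +-mono-≤ ([]≤1 (mem F p q)) (count-≤ F es)

  count-< : (F : EdgeSubset G) {es : List (Pair V)} →
            Any (λ e → ¬ T (mem F (proj₁ e) (proj₂ e))) es → count F es < length es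
  count-< F {(p , q) ∷ es} (here ¬pq) rewrite []-false ¬pq = s≤s (count-≤ F es)
  count-< F {(p , q) ∷ es} (there m) =
    subst (_≤ suc (length es)) (+-suc [ mem F p q ] (count F es))
          (+-mono-≤ ([]≤1 (mem F p q)) (count-< F m))

  isEdge : Pair V → V → V → Bool
  isEdge (p , q) u v = arc p q u v ∨ arc q p u v

  isEdge-sym : (e : Pair V) (u v : V) → isEdge e u v ≡ isEdge e v u
  isEdge-sym (p , q) u v =
    trans (∨-comm (arc p q u v) (arc q p u v))
          (cong₂ _∨_ (∧-comm (u ≡? q) (v ≡? p)) (∧-comm (u ≡? p) (v ≡? q)))

  isEdge-sound : (p q u v : V) → T (isEdge (p , q) u v) → SameEdge u v p q
  isEdge-sound p q u v t = Sum.map arc-sound arc-sound (Equivalence.to (T-∨ {arc p q u v}) t)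

  isEdge-self : (p q : V) → T (isEdge (p , q) p q)
  isEdge-self p q rewrite arc-self p q = _

  inEdges : List (Pair V) → V → V → Bool
  inEdges []       u v = false
  inEdges (e ∷ es) u v = isEdge e u v ∨ inEdges es u v

  inEdges-sym : (es : List (Pair V)) (u v : V) → inEdges es u v ≡ inEdges es v u
  inEdges-sym []       u v = refl
  inEdges-sym (e ∷ es) u v = cong₂ _∨_ (isEdge-sym e u v) (inEdges-sym es u v)

  inEdges-covers : {es : List (Pair V)} {e : Pair V} → e ∈ es → T (inEdges es (proj₁ e) (proj₂ e))
  inEdges-covers {(p , q) ∷ _} (here refl) = Equivalence.from T-∨ (inj₁ (isEdge-self p q))
  inEdges-covers (there e∈)                 = Equivalence.from T-∨ (inj₂ (inEdges-covers e∈))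

  inEdges-adj : {es : List (Pair V)} → All (λ e → Adj G (proj₁ e) (proj₂ e)) es →
                (u v : V) → T (inEdges es u v) → Adj G u v
  inEdges-adj {(p , q) ∷ es} (pq ∷ rest) u v t with Equivalence.to T-∨ t
  ... | inj₂ t′ = inEdges-adj rest u v t′
  ... | inj₁ e  with isEdge-sound p q u v e
  ...   | inj₁ (refl , refl) = pq
  ...   | inj₂ (refl , refl) = adj-sym′ pq

  inEdges-end : {es : List (Pair V)} {u v : V} → T (inEdges es u v) → u ∈ ends es
  inEdges-end {(p , q) ∷ es} {u} {v} t with Equivalence.to T-∨ t
  ... | inj₂ t′ = there (there (inEdges-end t′))
  ... | inj₁ e  with isEdge-sound p q u v e
  ...   | inj₁ (refl , _) = here refl
  ...   | inj₂ (refl , _) = there (here refl)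

  sameEdge-functional : {p q u v v′ : V} → p ≢ q → SameEdge u v p q → SameEdge u v′ p q → v ≡ v′
  sameEdge-functional _   (inj₁ (refl , refl)) (inj₁ (_ , refl)) = refl
  sameEdge-functional p≢q (inj₁ (refl , refl)) (inj₂ (p≡q , _))  = ⊥-elim (p≢q p≡q)
  sameEdge-functional p≢q (inj₂ (refl , refl)) (inj₁ (q≡p , _))  = ⊥-elim (p≢q (sym q≡p))
  sameEdge-functional _   (inj₂ (refl , refl)) (inj₂ (_ , refl)) = refl

  head-end-fresh : {p q u v : V} {es : List (Pair V)} → Unique (ends ((p , q) ∷ es)) →
                   SameEdge u v p q → u ∉ ends es
  head-end-fresh ((_ ∷ p∉) ∷ _)     (inj₁ (refl , _)) = All¬⇒¬Any p∉
  head-end-fresh (_ ∷ q∉ ∷ _)       (inj₂ (refl , _)) = All¬⇒¬Any q∉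

  inEdges-functional : {es : List (Pair V)} → Unique (ends es) →
    {u v v′ : V} → T (inEdges es u v) → T (inEdges es u v′) → v ≡ v′
  inEdges-functional {(p , q) ∷ es} U@((p≢q ∷ _) ∷ _ ∷ rest) {u} {v} {v′} t t′
    with Equivalence.to (T-∨ {isEdge (p , q) u v}) t | Equivalence.to (T-∨ {isEdge (p , q) u v′}) t′
  ... | inj₁ e | inj₁ e′ = sameEdge-functional p≢q (isEdge-sound p q u v e) (isEdge-sound p q u v′ e′)
  ... | inj₁ e | inj₂ r′ = ⊥-elim (head-end-fresh U (isEdge-sound p q u v e) (inEdges-end {es} r′))
  ... | inj₂ r | inj₁ e′ = ⊥-elim (head-end-fresh U (isEdge-sound p q u v′ e′) (inEdges-end {es} r))
  ... | inj₂ r | inj₂ r′ = inEdges-functional rest r r′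

  edgeSet : (es : List (Pair V)) → All (λ e → Adj G (proj₁ e) (proj₂ e)) es → EdgeSubset G
  edgeSet es es-adj = record
    { mem = inEdges es ; mem-sym = inEdges-sym es ; mem-adj = inEdges-adj es-adj }

  edgeSet-matching : {es : List (Pair V)} (es-adj : All (λ e → Adj G (proj₁ e) (proj₂ e)) es) →
                     Unique (ends es) → IsMatching (edgeSet es es-adj)
  edgeSet-matching {es} _ U u =
    sumFin-atMostOne _ (λ v → []≤1 (inEdges es u v))
      (λ v v′ uv uv′ → inEdges-functional U ([]-positive uv) ([]-positive uv′))

  partner : (P : EdgeSubset G) → IsPerfectMatching P → (z : V) → Σ V λ t → T (mem P z t)
  partner P pm z with sumFin-positive _ (subst (0 <_) (sym (pm z)) z<s)
  ... | t , zt = t , []-positive zt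

  matched-once : (P : EdgeSubset G) → IsPerfectMatching P → {t u v : V} → u ≢ v →
                 T (mem P t u) → T (mem P t v) → ⊥
  matched-once P pm {t} u≢v tu tv =
    <-irrefl refl (subst₂ _≤_ (cong₂ _+_ ([]-true tu) ([]-true tv)) (pm t)
                              (sumFin-two (λ s → [ mem P t s ]) u≢v))

  perfect-misses : (P : EdgeSubset G) → IsPerfectMatching P → {z t : V} {es : List (Pair V)} →
    z ∉ ends es → t ∈ ends es → T (mem P z t) → Any (λ e → ¬ T (mem P (proj₁ e) (proj₂ e))) es
  perfect-misses P pm {z} {es = (p , q) ∷ es} z∉ (here refl) zt =
    here (matched-once P pm (z∉ ∘ there ∘ here) (subst T (mem-sym P z p) zt))
  perfect-misses P pm {z} {es = (p , q) ∷ es} z∉ (there (here refl)) zt =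
    here (λ pq → matched-once P pm (z∉ ∘ here) (subst T (mem-sym P z q) zt)
                                                (subst T (mem-sym P p q) pq))
  perfect-misses P pm {es = _ ∷ es} z∉ (there (there t∈)) zt =
    there (perfect-misses P pm (z∉ ∘ there ∘ there) t∈ zt)

  surrounded⇒eta : {z : V} {e : Pair V} {es : List (Pair V)} →
    Surrounded (Adj G) z (e ∷ es) → EtaAtMost G (length es) (length (e ∷ es))
  surrounded⇒eta {z} {e@(p , q)} {es} s@record { edges = pq ∷ _ } =
    edgesWeight (e ∷ es) , edgesWeight-nonzero {es = es} pq ,
    M , edgeSet-matching (edges s) (disjoint s) , bound
    where
    k : ℕ
    k = length es

    M : EdgeSubset G
    M = edgeSet (e ∷ es) (edges s)

    weight-M : weightOf (edgesWeight (e ∷ es)) M ≡ suc k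
    weight-M = trans (weightOf-edges (edges s) M)
                     (count-all M (All.tabulate (inEdges-covers {e ∷ es})))

    weight-P : (P : EdgeSubset G) → IsPerfectMatching P → weightOf (edgesWeight (e ∷ es)) P ≤ k
    weight-P P pm with partner P pm z
    ... | t , zt = ≤-pred (subst (_< suc k) (sym (weightOf-edges (edges s) P))
                     (count-< P {e ∷ es} (perfect-misses P pm (centre∉ s)
                       (neighbours s t (mem-adj P z t zt)) zt)))

    bound : (P : EdgeSubset G) → IsPerfectMatching P →
            suc k * weightOf (edgesWeight (e ∷ es)) P ≤ k * weightOf (edgesWeight (e ∷ es)) M
    bound P pm = subst (suc k * weightOf (edgesWeight (e ∷ es)) P ≤_)
                       (trans (*-comm (suc k) k) (cong (k *_) (sym weight-M)))
                       (*-monoʳ-≤ (suc k) (weight-P P pm))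

Remaining : (H : Graph) (a a' b b' : Fin (n H)) → Fin (n H) → Fin (n H) → Set
Remaining H a a' b b' i j = Adj H i j × ¬ SameEdge i j a a' × ¬ SameEdge i j b b'

module DotEmbedding {G H : Graph} (dd : DotData G H) {D : Graph}
                    (iso : IsDotProductVia G H dd D) where

  private
    φ = proj₁ iso

    DA : DotVerts G (x dd) (y dd) H → DotVerts G (x dd) (y dd) H → Set
    DA = DotAdj G (x dd) (y dd) (x₁ dd) (x₂ dd) (y₁ dd) (y₂ dd) H (a dd) (a' dd) (b dd) (b' dd)

    R− : Fin (n H) → Fin (n H) → Set
    R− = Remaining H (a dd) (a' dd) (b dd) (b' dd)

  embed : Fin (n H) → Fin (n D)
  embed i = Inverse.from φ (inj₂ i)

  to-embed : ∀ i → Inverse.to φ (embed i) ≡ inj₂ i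
  to-embed i = Inverse.strictlyInverseˡ φ (inj₂ i)

  embed-injective : ∀ {i j} → embed i ≡ embed j → i ≡ j
  embed-injective {i} {j} eq =
    inj₂-injective (trans (sym (to-embed i)) (trans (cong (Inverse.to φ) eq) (to-embed j)))

  embed-edge : ∀ {i j} → R− i j → Adj D (embed i) (embed j)
  embed-edge {i} {j} r =
    proj₂ (proj₂ iso (embed i) (embed j)) (subst₂ DA (sym (to-embed i)) (sym (to-embed j)) r)

  -- A vertex of H that is no endpoint of aa', bb' has no edges to G − {x,y}.
  private
    no-link : ∀ {c} → c ∉ a dd ∷ a' dd ∷ b dd ∷ b' dd ∷ [] →
              ∀ v → DA (inj₂ c) v → Σ (Fin (n H)) λ j → v ≡ inj₂ j × R− c j
    no-link c∉ (inj₁ _) (inj₁ (_ , c≡a))                 = ⊥-elim (c∉ (here c≡a))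
    no-link c∉ (inj₁ _) (inj₂ (inj₁ (_ , c≡a')))         = ⊥-elim (c∉ (there (here c≡a')))
    no-link c∉ (inj₁ _) (inj₂ (inj₂ (inj₁ (_ , c≡b))))   = ⊥-elim (c∉ (there (there (here c≡b))))
    no-link c∉ (inj₁ _) (inj₂ (inj₂ (inj₂ (_ , c≡b'))))  =
      ⊥-elim (c∉ (there (there (there (here c≡b')))))
    no-link c∉ (inj₂ j) r = j , refl , r

  embed-neighbours : ∀ {c} → c ∉ a dd ∷ a' dd ∷ b dd ∷ b' dd ∷ [] →
                     ∀ t → Adj D (embed c) t → Σ (Fin (n H)) λ j → t ≡ embed j × R− c j
  embed-neighbours {c} c∉ t ct
    with no-link c∉ (Inverse.to φ t) (subst (λ v → DA v (Inverse.to φ t)) (to-embed c)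
                                            (proj₁ (proj₂ iso (embed c) t) ct))
  ... | j , t↦j , r = j , trans (sym (Inverse.strictlyInverseʳ φ t)) (cong (Inverse.from φ) t↦j) , r

  embed-surrounded : ∀ {c es} → c ∉ a dd ∷ a' dd ∷ b dd ∷ b' dd ∷ [] →
    Surrounded R− c es → Surrounded (Adj D) (embed c) (map (mapPair embed) es)
  embed-surrounded c∉ = surrounded-embed embed embed-injective embed-edge (embed-neighbours c∉)

private
  R : Graph
  R = Petersen

  open DecMembership (_≟_ {10}) using (_∈?_; _∉?_)
  open DecUnique (_≟_ {10}) using (unique?)

surrounded? : (c : Fin 10) (es : List (Pair (Fin 10))) → Dec (Surrounded (Adj R) c es)
surrounded? c es =
  map′ (λ (ed , dj , c∉ , nb) →
         record { edges = ed ; disjoint = dj ; centre∉ = c∉ ; neighbours = nb })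
       (λ s → edges s , disjoint s , centre∉ s , neighbours s)
       (All.all? (λ e → T? (adj R (proj₁ e) (proj₂ e))) es ×-dec unique? (ends es) ×-dec
        c ∉? ends es ×-dec allFin? (λ t → T? (adj R c t) →-dec t ∈? ends es))

Candidate : Set
Candidate = Fin 10 × Pair (Fin 10) × Pair (Fin 10) × Pair (Fin 10)

centre : Candidate → Fin 10
centre = proj₁

around : Candidate → List (Pair (Fin 10))
around (_ , e₁ , e₂ , e₃) = e₁ ∷ e₂ ∷ e₃ ∷ []

-- Each centre is followed by one edge at each of its three neighbours.
candidates : List Candidate
candidates = (0F , (1F , 2F) , (4F , 3F) , (5F , 7F)) ∷
             (3F , (2F , 7F) , (4F , 9F) , (8F , 5F)) ∷
             (6F , (1F , 2F) , (8F , 5F) , (9F , 7F)) ∷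
             (7F , (2F , 3F) , (5F , 0F) , (9F , 4F)) ∷
             (5F , (0F , 1F) , (7F , 2F) , (8F , 3F)) ∷ []

-- The two finite checks are opaque so that uses of them never unfold the
-- decision procedures.
opaque
  candidates-surrounded : All (λ t → Surrounded (Adj R) (centre t) (around t)) candidates
  candidates-surrounded = from-yes (All.all? (λ t → surrounded? (centre t) (around t)) candidates)

Avoids : (a a' b b' : Fin 10) → Candidate → Set
Avoids a a' b b' t = centre t ∉ a ∷ a' ∷ b ∷ b' ∷ [] ×
  All (λ e → ¬ SameEdge (proj₁ e) (proj₂ e) a a' × ¬ SameEdge (proj₁ e) (proj₂ e) b b') (around t)

TwoMatching : (a a' b b' : Fin 10) → Set
TwoMatching a a' b b' = Adj R a a' × Adj R b b' × a ≢ b × a ≢ b' × a' ≢ b × a' ≢ b'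

opaque
  candidates-cover : ∀ a a' b b' → TwoMatching a a' b b' → Any (Avoids a a' b b') candidates
  candidates-cover = from-yes
    (allFin? λ a → allFin? λ a' → allFin? λ b → allFin? λ b' →
      twoMatching? a a' b b' →-dec Any.any? (avoids? a a' b b') candidates)
    where
    sameEdge? : (i j p q : Fin 10) → Dec (SameEdge i j p q)
    sameEdge? i j p q = (i ≟ p ×-dec j ≟ q) ⊎-dec (i ≟ q ×-dec j ≟ p)

    avoids? : ∀ a a' b b' t → Dec (Avoids a a' b b' t)
    avoids? a a' b b' t = centre t ∉? (a ∷ a' ∷ b ∷ b' ∷ []) ×-dec
      All.all? (λ e → ¬? (sameEdge? (proj₁ e) (proj₂ e) a a') ×-dec
                      ¬? (sameEdge? (proj₁ e) (proj₂ e) b b')) (around t)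

    twoMatching? : ∀ a a' b b' → Dec (TwoMatching a a' b b')
    twoMatching? a a' b b' = T? (adj R a a') ×-dec T? (adj R b b') ×-dec ¬? (a ≟ b) ×-dec
                             ¬? (a ≟ b') ×-dec ¬? (a' ≟ b) ×-dec ¬? (a' ≟ b')

SurroundedOff : (a a' b b' : Fin 10) → Candidate → Set
SurroundedOff a a' b b' t =
  centre t ∉ a ∷ a' ∷ b ∷ b' ∷ [] × Surrounded (Remaining R a a' b b') (centre t) (around t)

petersen-surrounded : ∀ {a a' b b'} → TwoMatching a a' b b' → Σ Candidate (SurroundedOff a a' b b')
petersen-surrounded {a} {a'} {b} {b'} m =
  let (s , c∉ , avoid) = All.lookupAny candidates-surrounded (candidates-cover a a' b b' m)
  in  _ , c∉ , surrounded-restrict proj₁ (All.zip (edges s , avoid)) s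

proposition3p10 : (G : Graph) → Snark G →
    (dd : DotData G Petersen) →
    AtDistanceOne Petersen (a dd) (a' dd) (b dd) (b' dd) →
    (D : Graph) → IsDotProductVia G Petersen dd D → Snark D →
    EtaAtMost D 2 3
proposition3p10 G _ dd _ D iso _ =
  let (_ , c∉ , s) = petersen-surrounded (aa' dd , bb' dd , a≢b dd , a≢b' dd , a'≢b dd , a'≢b' dd)
  in  surrounded⇒eta {D} (embed-surrounded c∉ s)
  where open DotEmbedding {G} {Petersen} dd {D} iso
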